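{- Let $q$ be a prime power and $0<k<n$, $0\le t\le k$ integers. If $t=k$, then $\mathcal{C}_k(n,k)=\mathcal{I}_k(n,k)$. If $t<k$ and $q>\binom{n}{t}^{1/(k-t)}$, then $\mathcal{C}_t(n,k)\neq\emptyset$ and $\mathcal{I}_t(n,k)=\emptyset$.
   Context: Let $V=\mathbb{F}_q^n$. An $[n,m]$-linear code is an $m$-dimensional subspace of $V$; $\mathcal{C}_t(n,m)$ denotes the set of $[n,m]$-codes such that any $t$ columns of a generator matrix (an $m\times n$ matrix whose rows form a basis) are linearly independent. A code $C\in\mathcal{C}_t(n,k)$ is isolated if it contains no subspace in $\mathcal{C}_t(n,k-1)$; $\mathcal{I}_t(n,k)$ is the set of isolated codes. -}

module Defs where

open import Level using (Level; _⊔_)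
open import Data.Nat using (ℕ; _^_; _<_)
open import Data.Nat.Primality using (Prime)
open import Data.Fin using (Fin)
open import Data.Product using (Σ; ∃; _×_; _,_)
open import Function.Definitions using (Injective)
open import Relation.Binary.PropositionalEquality using (_≡_)
open import Relation.Nullary using (¬_)
open import Algebra.Bundles using (CommutativeRing)

IsPrimePower : ℕ → Set
IsPrimePower q = Σ ℕ λ p → Σ ℕ λ e → Prime p × (0 < e) × (q ≡ p ^ e)

record Field (c ℓ : Level) : Set (Level.suc (c ⊔ ℓ)) where
  field
    commRing : CommutativeRing c ℓ
  open CommutativeRing commRing public
  field
    1≉0     : ¬ (1# ≈ 0#)
    inverse : ∀ x → ¬ (x ≈ 0#) → Σ Carrier λ y → (x * y) ≈ 1#

record FiniteField (q : ℕ) (c ℓ : Level) : Set (Level.suc (c ⊔ ℓ)) where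
  field
    fld : Field c ℓ
  open Field fld public
  field
    enum      : Fin q → Carrier
    enum-inj  : ∀ i j → enum i ≈ enum j → i ≡ j
    enum-surj : ∀ x → Σ (Fin q) λ i → enum i ≈ x

module Codes {c ℓ : Level} (F : Field c ℓ) where
  open Field F using (Carrier; _≈_; _+_; _*_; 0#)

  Vec : ℕ → Set c
  Vec n = Fin n → Carrier

  Mat : ℕ → ℕ → Set c
  Mat m n = Fin m → Fin n → Carrier

  sumF : ∀ {m} → (Fin m → Carrier) → Carrier
  sumF {ℕ.zero}  f = 0#
  sumF {ℕ.suc m} f = f Fin.zero + sumF (λ i → f (Fin.suc i))

  lincomb : ∀ {m n} → (Fin m → Carrier) → (Fin m → Vec n) → Vec n
  lincomb a v j = sumF (λ i → a i * v i j)

  LinIndep : ∀ {m n} → (Fin m → Vec n) → Set (c ⊔ ℓ)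
  LinIndep {m} {n} v = ∀ (a : Fin m → Carrier) →
    (∀ j → lincomb a v j ≈ 0#) → ∀ i → a i ≈ 0#

  -- An [n,m]-code is the m-dimensional subspace of F^n spanned by the rows
  -- of an m × n generator matrix G whose rows are linearly independent.
  IsGenerator : ∀ {m n} → Mat m n → Set (c ⊔ ℓ)
  IsGenerator G = LinIndep G

  _∈Code_ : ∀ {m n} → Vec n → Mat m n → Set (c ⊔ ℓ)
  _∈Code_ {m} {n} x G = Σ (Fin m → Carrier) λ a → ∀ j → lincomb a G j ≈ x j

  _⊆Code_ : ∀ {m m' n} → Mat m' n → Mat m n → Set (c ⊔ ℓ)
  H ⊆Code G = ∀ r → H r ∈Code G

  column : ∀ {m n} → Mat m n → Fin n → Vec m
  column G j i = G i j

  AnyColsIndep : ∀ {m n} (t : ℕ) → Mat m n → Set (c ⊔ ℓ)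
  AnyColsIndep {m} {n} t G = ∀ (f : Fin t → Fin n) → Injective _≡_ _≡_ f →
    LinIndep (λ i → column G (f i))

  InC : ∀ {m n} (t : ℕ) → Mat m n → Set (c ⊔ ℓ)
  InC t G = IsGenerator G × AnyColsIndep t G

  InI : ∀ {k n} (t : ℕ) → Mat k n → Set (c ⊔ ℓ)
  InI {k} {n} t G = InC t G ×
    ¬ (Σ (Mat (k Data.Nat.∸ 1) n) λ H → InC t H × H ⊆Code G)

{-# OPTIONS --safe #-}
module Submission where

-- The vectors G c with c of weight at most t (the union of the spans of any t columns of
-- the k × n generator G) are at most C(n,t) q^t < q^k many, so some v ∈ F_q^k avoids them all.
-- Projecting F_q^k onto F_q^(k-1) along v turns G into a (k-1)-row generator of a subcode
-- whose columns remain t-wise independent: a dependency among t projected columns would make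
-- a nonzero multiple of v a combination of t columns of G. This shows that no code is
-- isolated, and iterating it from the n × n identity matrix gives a code in 𝒞_t(n,k).
-- For t = k, a code in 𝒞_k(n,k-1) would have k independent columns in F_q^(k-1), which a
-- pigeonhole count over the q^k coefficient vectors rules out.

open import Defs
open import Level using (Level; _⊔_)
open import Data.Nat using (ℕ; _<_; _≤_; _^_; _∸_)
open import Data.Nat.Combinatorics using (_C_)
open import Data.Product using (Σ; _×_)
open import Data.Empty using (⊥)
open import Function.Bundles using (_⇔_)
open import Relation.Binary.PropositionalEquality using (_≡_)

import Data.Nat as ℕ
open import Data.Nat using (NonZero; zero; suc; z≤n; s≤s; _≤‴_; ≤‴-refl; ≤‴-step)
open import Data.Nat.Properties using (<⇒≤; <-trans; n≮0; ^-monoʳ-<; n<1+n; ≤⇒≤‴)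
open import Data.Fin as Fin using (Fin; zero; suc; punchIn; punchOut; _↑ˡ_; _↑ʳ_)
open import Data.Fin.Properties
  using (any?; all?; ¬∀⟶∃¬; pigeonhole; <⇒≢; combine-remQuot; combine-injective; remQuot-combine;
         splitAt-↑ˡ; splitAt-↑ʳ; punchIn-punchOut; punchIn-injective; punchInᵢ≢i; inject≤-injective)
open import Data.Vec.Functional using (_∷_; tail)
open import Data.Product using (_,_; proj₁; proj₂)
open import Data.Sum using (_⊎_; inj₁; inj₂; [_,_]′)
open import Data.Empty using (⊥-elim)
open import Data.Unit.Polymorphic using (⊤)
open import Function using (_∘_)
open import Function.Bundles using (mk⇔)
open import Relation.Nullary using (¬_; Dec; yes; no)
open import Function.Definitions using (Injective)
open import Relation.Binary.Definitions using (Decidable)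
import Relation.Binary.PropositionalEquality as ≡
open import Relation.Binary.PropositionalEquality using (_≢_)

module _ where
  open import Data.Nat using (_+_; _*_)
  open import Data.Nat.Properties
    using (≤-refl; ≤-trans; ≤-<-trans; n≤1+n; m≤n*m; +-mono-≤; *-monoʳ-≤; *-monoˡ-≤; *-monoˡ-<; *-identityˡ;
           *-commutativeSemigroup; *-distribʳ-+; +-comm; ^-distribˡ-+-*; m∸n+n≡m; m^n≢0; m≤n⇒m<n∨m≡n;
           module ≤-Reasoning)
  open import Data.Nat.Combinatorics using (nCn≡1; nCk+nC[k+1]≡[n+1]C[k+1])
  open import Algebra.Properties.CommutativeSemigroup *-commutativeSemigroup using (x∙yz≈y∙xz)

  -- Number of words of length n and weight at most t over an alphabet with r nonzero letters.
  hammingBallSize : ℕ → ℕ → ℕ → ℕ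
  hammingBallSize r zero    t       = 1
  hammingBallSize r (suc n) zero    = hammingBallSize r n zero
  hammingBallSize r (suc n) (suc t) = hammingBallSize r n (suc t) + r * hammingBallSize r n t

  hammingBallSize-zero : ∀ r n → hammingBallSize r n 0 ≡ 1
  hammingBallSize-zero r zero    = ≡.refl
  hammingBallSize-zero r (suc n) = hammingBallSize-zero r n

  hammingBallSize≤^ : ∀ r n t → hammingBallSize r n t ≤ suc r ^ n
  hammingBallSize≤^ r zero    t       = ≤-refl
  hammingBallSize≤^ r (suc n) zero    = ≤-trans (hammingBallSize≤^ r n zero) (m≤n*m (suc r ^ n) (suc r))
  hammingBallSize≤^ r (suc n) (suc t) =
    +-mono-≤ (hammingBallSize≤^ r n (suc t)) (*-monoʳ-≤ r (hammingBallSize≤^ r n t))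

  hammingBallSize≤C* : ∀ r {n t} → t ≤ n → hammingBallSize r n t ≤ (n C t) * suc r ^ t
  hammingBallSize≤C* r {n} {zero} _ rewrite hammingBallSize-zero r n = ≤-refl
  hammingBallSize≤C* r {suc n} {suc t} (s≤s t≤n) with m≤n⇒m<n∨m≡n t≤n
  ... | inj₂ ≡.refl = begin
    hammingBallSize r n (suc n) + r * hammingBallSize r n n
      ≤⟨ +-mono-≤ (hammingBallSize≤^ r n (suc n)) (*-monoʳ-≤ r (hammingBallSize≤^ r n n)) ⟩
    suc r ^ suc n                    ≡⟨ *-identityˡ (suc r ^ suc n) ⟨
    1 * suc r ^ suc n                ≡⟨ ≡.cong (_* suc r ^ suc n) (nCn≡1 (suc n)) ⟨
    (suc n C suc n) * suc r ^ suc n  ∎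
    where open ≤-Reasoning
  ... | inj₁ t<n = begin
    hammingBallSize r n (suc t) + r * hammingBallSize r n t
      ≤⟨ +-mono-≤ (hammingBallSize≤C* r t<n) (*-monoʳ-≤ r (hammingBallSize≤C* r t≤n)) ⟩
    (n C suc t) * Q′ + r * ((n C t) * Q)
      ≤⟨ +-mono-≤ ≤-refl (*-monoˡ-≤ ((n C t) * Q) (n≤1+n r)) ⟩
    (n C suc t) * Q′ + suc r * ((n C t) * Q)
      ≡⟨ ≡.cong ((n C suc t) * Q′ +_) (x∙yz≈y∙xz (suc r) (n C t) Q) ⟩
    (n C suc t) * Q′ + (n C t) * Q′
      ≡⟨ *-distribʳ-+ Q′ (n C suc t) (n C t) ⟨
    (n C suc t + n C t) * Q′
      ≡⟨ ≡.cong (_* Q′) (≡.trans (+-comm (n C suc t) (n C t)) (nCk+nC[k+1]≡[n+1]C[k+1] n t)) ⟩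
    (suc n C suc t) * Q′ ∎
    where
      open ≤-Reasoning
      Q = suc r ^ t
      Q′ = suc r ^ suc t

  m<q^[k∸t]⇒m*q^t<q^k : ∀ q {k t m} .{{_ : NonZero q}} → t ≤ k → m < q ^ (k ∸ t) → m * q ^ t < q ^ k
  m<q^[k∸t]⇒m*q^t<q^k q {k} {t} {m} t≤k m<q^[k∸t] = begin-strict
    m * q ^ t           <⟨ *-monoˡ-< (q ^ t) {{m^n≢0 q t}} m<q^[k∸t] ⟩
    q ^ (k ∸ t) * q ^ t ≡⟨ ^-distribˡ-+-* q (k ∸ t) t ⟨
    q ^ (k ∸ t + t)     ≡⟨ ≡.cong (q ^_) (m∸n+n≡m t≤k) ⟩
    q ^ k               ∎
    where open ≤-Reasoning

  hammingBallSize<^ : ∀ r {n k t} → t ≤ k → k ≤ n → n C t < suc r ^ (k ∸ t) →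
    hammingBallSize r n t < suc r ^ k
  hammingBallSize<^ r t≤k k≤n bound =
    ≤-<-trans (hammingBallSize≤C* r (≤-trans t≤k k≤n)) (m<q^[k∸t]⇒m*q^t<q^k (suc r) t≤k bound)

module LinearAlgebra {c ℓ : Level} (F : Field c ℓ) where
  open Field F hiding (zero)
  open Codes F
  open import Algebra.Properties.Ring ring
    using (-1*x≈-x; -0#≈0#; x[y-z]≈xy-xz; [y-z]x≈yx-zx; x∙y⁻¹≈ε⇒x≈y; x≈y⇒x∙y⁻¹≈ε)
  open import Algebra.Properties.CommutativeSemigroup *-commutativeSemigroup
    using (x∙yz≈y∙xz; xy∙z≈yz∙x)
  open import Algebra.Properties.Semiring.Sum semiring
    using (sum; sum-cong-≋; sum-replicate-zero; ∑-distrib-+; *-distribˡ-sum; *-distribʳ-sum)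
  open import Data.Vec.Functional.Relation.Binary.Equality.Setoid setoid using (_≋_)
  open import Relation.Binary.Reasoning.Setoid setoid

  -- sumF agrees with the library's sum only propositionally, so the library's lemmas are transported.
  sumF≡sum : ∀ {m} (f : Fin m → Carrier) → sumF f ≡ sum f
  sumF≡sum {zero}  f = ≡.refl
  sumF≡sum {suc m} f = ≡.cong (f zero +_) (sumF≡sum (f ∘ suc))

  sumF-cong : ∀ {m} {f g : Fin m → Carrier} → f ≋ g → sumF f ≈ sumF g
  sumF-cong {f = f} {g} f≋g = ≡.subst₂ _≈_ (≡.sym (sumF≡sum f)) (≡.sym (sumF≡sum g)) (sum-cong-≋ f≋g)

  sumF-zero : ∀ {m} {f : Fin m → Carrier} → f ≋ (λ _ → 0#) → sumF f ≈ 0#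
  sumF-zero {m} f≋0 = trans (sumF-cong f≋0) (trans (reflexive (sumF≡sum {m} _)) (sum-replicate-zero m))

  sumF-distrib-+ : ∀ {m} (f g : Fin m → Carrier) → sumF (λ i → f i + g i) ≈ sumF f + sumF g
  sumF-distrib-+ {m} f g =
    ≡.subst₂ _≈_ (≡.sym (sumF≡sum {m} _)) (≡.sym (≡.cong₂ _+_ (sumF≡sum f) (sumF≡sum g))) (∑-distrib-+ f g)

  sumF-comm : ∀ {m k} (A : Fin m → Fin k → Carrier) →
    sumF (λ i → sumF (λ j → A i j)) ≈ sumF (λ j → sumF (λ i → A i j))
  sumF-comm {zero}  {k} A = sym (sumF-zero {k} (λ _ → refl))
  sumF-comm {suc m}     A = trans (+-congˡ (sumF-comm (A ∘ suc))) (sym (sumF-distrib-+ (A zero) _))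

  *-distribˡ-sumF : ∀ {m} x (f : Fin m → Carrier) → x * sumF f ≈ sumF (λ i → x * f i)
  *-distribˡ-sumF {m} x f =
    ≡.subst₂ _≈_ (≡.sym (≡.cong (x *_) (sumF≡sum f))) (≡.sym (sumF≡sum {m} _)) (*-distribˡ-sum x f)

  *-distribʳ-sumF : ∀ {m} x (f : Fin m → Carrier) → sumF f * x ≈ sumF (λ i → f i * x)
  *-distribʳ-sumF {m} x f =
    ≡.subst₂ _≈_ (≡.sym (≡.cong (_* x) (sumF≡sum f))) (≡.sym (sumF≡sum {m} _)) (*-distribʳ-sum x f)

  sumF-distrib-sub : ∀ {m} (f g : Fin m → Carrier) → sumF (λ i → f i - g i) ≈ sumF f - sumF g
  sumF-distrib-sub f g = begin
    sumF (λ i → f i - g i)            ≈⟨ sumF-distrib-+ f (λ i → - g i) ⟩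
    sumF f + sumF (λ i → - g i)       ≈⟨ +-congˡ (sumF-cong (λ i → sym (-1*x≈-x (g i)))) ⟩
    sumF f + sumF (λ i → - 1# * g i)  ≈⟨ +-congˡ (*-distribˡ-sumF (- 1#) g) ⟨
    sumF f + - 1# * sumF g            ≈⟨ +-congˡ (-1*x≈-x (sumF g)) ⟩
    sumF f - sumF g                   ∎

  lincomb-congˡ : ∀ {m n} {a b : Fin m → Carrier} (v : Fin m → Vec n) → a ≋ b →
    lincomb a v ≋ lincomb b v
  lincomb-congˡ v a≋b j = sumF-cong (λ i → *-congʳ (a≋b i))

  lincomb-congʳ : ∀ {m n} (a : Fin m → Carrier) {v w : Fin m → Vec n} → (∀ i → v i ≋ w i) →
    lincomb a v ≋ lincomb a w
  lincomb-congʳ a v≋w j = sumF-cong (λ i → *-congˡ (v≋w i j))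

  lincomb-zero : ∀ {m n} (v : Fin m → Vec n) → lincomb (λ _ → 0#) v ≋ (λ _ → 0#)
  lincomb-zero v j = sumF-zero (λ i → zeroˡ (v i j))

  lincomb-scale : ∀ {m n} x (a : Fin m → Carrier) (v : Fin m → Vec n) →
    lincomb (λ i → x * a i) v ≋ (λ j → x * lincomb a v j)
  lincomb-scale x a v j = begin
    sumF (λ i → (x * a i) * v i j)  ≈⟨ sumF-cong (λ i → *-assoc x (a i) (v i j)) ⟩
    sumF (λ i → x * (a i * v i j))  ≈⟨ *-distribˡ-sumF x (λ i → a i * v i j) ⟨
    x * lincomb a v j               ∎

  lincomb-sub : ∀ {m n} (a b : Fin m → Carrier) (v : Fin m → Vec n) →
    lincomb (λ i → a i - b i) v ≋ (λ j → lincomb a v j - lincomb b v j)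
  lincomb-sub a b v j = begin
    sumF (λ i → (a i - b i) * v i j)
      ≈⟨ sumF-cong (λ i → [y-z]x≈yx-zx (v i j) (a i) (b i)) ⟩
    sumF (λ i → a i * v i j - b i * v i j)
      ≈⟨ sumF-distrib-sub (λ i → a i * v i j) (λ i → b i * v i j) ⟩
    lincomb a v j - lincomb b v j ∎

  lincomb-lincomb : ∀ {m k n} (a : Fin m → Carrier) (W : Fin m → Vec k) (G : Fin k → Vec n) →
    lincomb a (λ r → lincomb (W r) G) ≋ lincomb (lincomb a W) G
  lincomb-lincomb a W G j = begin
    sumF (λ r → a r * sumF (λ s → W r s * G s j))
      ≈⟨ sumF-cong (λ r → *-distribˡ-sumF (a r) (λ s → W r s * G s j)) ⟩
    sumF (λ r → sumF (λ s → a r * (W r s * G s j)))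
      ≈⟨ sumF-cong (λ r → sumF-cong (λ s → sym (*-assoc (a r) (W r s) (G s j)))) ⟩
    sumF (λ r → sumF (λ s → (a r * W r s) * G s j))
      ≈⟨ sumF-comm (λ r s → (a r * W r s) * G s j) ⟩
    sumF (λ s → sumF (λ r → (a r * W r s) * G s j))
      ≈⟨ sumF-cong (λ s → *-distribʳ-sumF (G s j) (λ r → a r * W r s)) ⟨
    sumF (λ s → lincomb a W s * G s j) ∎

  column-lincomb : ∀ {m k n} (W : Fin m → Vec k) (G : Fin k → Vec n) j →
    column (λ r → lincomb (W r) G) j ≋ lincomb (column G j) (column W)
  column-lincomb W G j r = sumF-cong (λ s → *-comm (W r s) (G s j))

  LinIndep⇒lincomb-injective : ∀ {m n} {v : Fin m → Vec n} → LinIndep v →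
    ∀ {a b} → lincomb a v ≋ lincomb b v → a ≋ b
  LinIndep⇒lincomb-injective {v = v} v-indep {a} {b} av≋bv i =
    x∙y⁻¹≈ε⇒x≈y (a i) (b i) (v-indep (λ i → a i - b i) [a-b]v≋0 i)
    where
      [a-b]v≋0 : lincomb (λ i → a i - b i) v ≋ (λ _ → 0#)
      [a-b]v≋0 j = trans (lincomb-sub a b v j) (x≈y⇒x∙y⁻¹≈ε (av≋bv j))

  LinIndep-lincomb : ∀ {m k n} {W : Fin m → Vec k} {G : Fin k → Vec n} → LinIndep W → LinIndep G →
    LinIndep (λ r → lincomb (W r) G)
  LinIndep-lincomb {W = W} {G} W-indep G-indep a aWG≈0 =
    W-indep a (G-indep (lincomb a W) (λ j → trans (sym (lincomb-lincomb a W G j)) (aWG≈0 j)))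

  δ : ∀ {m} → Fin m → Fin m → Carrier
  δ zero    zero    = 1#
  δ zero    (suc _) = 0#
  δ (suc _) zero    = 0#
  δ (suc i) (suc j) = δ i j

  δ-sym : ∀ {m} (i j : Fin m) → δ i j ≡ δ j i
  δ-sym zero    zero    = ≡.refl
  δ-sym zero    (suc j) = ≡.refl
  δ-sym (suc i) zero    = ≡.refl
  δ-sym (suc i) (suc j) = δ-sym i j

  δ-diag : ∀ {m} (i : Fin m) → δ i i ≡ 1#
  δ-diag zero    = ≡.refl
  δ-diag (suc i) = δ-diag i

  δ-≢ : ∀ {m} {i j : Fin m} → i ≢ j → δ i j ≡ 0#
  δ-≢ {i = zero}  {zero}  i≢j = ⊥-elim (i≢j ≡.refl)
  δ-≢ {i = zero}  {suc j} i≢j = ≡.refl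
  δ-≢ {i = suc i} {zero}  i≢j = ≡.refl
  δ-≢ {i = suc i} {suc j} i≢j = δ-≢ (i≢j ∘ ≡.cong suc)

  δ-injective : ∀ {m k} {f : Fin m → Fin k} → Injective _≡_ _≡_ f → ∀ i j → δ (f i) (f j) ≡ δ i j
  δ-injective {f = f} f-inj i j with i Fin.≟ j
  ... | yes ≡.refl = ≡.trans (δ-diag (f i)) (≡.sym (δ-diag i))
  ... | no i≢j     = ≡.trans (δ-≢ (i≢j ∘ f-inj)) (≡.sym (δ-≢ i≢j))

  sumF-δ : ∀ {m} (i : Fin m) (u : Fin m → Carrier) → sumF (λ s → δ i s * u s) ≈ u i
  sumF-δ zero    u =
    trans (+-cong (*-identityˡ (u zero)) (sumF-zero (λ s → zeroˡ (u (suc s))))) (+-identityʳ (u zero))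
  sumF-δ (suc i) u = trans (+-cong (zeroˡ (u zero)) (sumF-δ i (u ∘ suc))) (+-identityˡ (u (suc i)))

  lincomb-δ : ∀ {m n} (i : Fin m) (v : Fin m → Vec n) → lincomb (δ i) v ≋ v i
  lincomb-δ i v j = sumF-δ i (λ s → v s j)

  lincomb-identity : ∀ {m} (a : Fin m → Carrier) → lincomb a δ ≋ a
  lincomb-identity a j =
    trans (sumF-cong (λ i → trans (*-comm (a i) (δ i j)) (*-congʳ (reflexive (δ-sym i j))))) (sumF-δ j a)

  InC-identity : ∀ {n} t → InC t (δ {n})
  InC-identity t = rows-indep , cols-indep
    where
      δ-column : ∀ {f : Fin t → Fin _} → Injective _≡_ _≡_ f → ∀ {i} k → δ k i ≡ column δ (f k) (f i)
      δ-column f-inj {i} k = ≡.trans (δ-sym k i) (≡.sym (δ-injective f-inj i k))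
      rows-indep : LinIndep δ
      rows-indep a a≋0 j = trans (sym (lincomb-identity a j)) (a≋0 j)
      cols-indep : AnyColsIndep t δ
      cols-indep f f-inj a a≋0 i = begin
        a i                                     ≈⟨ lincomb-identity a i ⟨
        lincomb a δ i                           ≈⟨ sumF-cong (λ k → *-congˡ (reflexive (δ-column f-inj k))) ⟩
        lincomb a (λ k → column δ (f k)) (f i)  ≈⟨ a≋0 (f i) ⟩
        0#                                      ∎

  Weight≤ : ∀ {m} → ℕ → Vec m → Set ℓ
  Weight≤ {zero}  t       c = ⊤
  Weight≤ {suc m} zero    c = c zero ≈ 0# × Weight≤ zero (tail c)
  Weight≤ {suc m} (suc t) c = (c zero ≈ 0# × Weight≤ (suc t) (tail c)) ⊎ Weight≤ t (tail c)

  Weight≤-cong : ∀ {m} t {c d : Vec m} → c ≋ d → Weight≤ t c → Weight≤ t d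
  Weight≤-cong {zero}  t       c≋d _ = _
  Weight≤-cong {suc m} zero    c≋d (c₀≈0 , w) =
    trans (sym (c≋d zero)) c₀≈0 , Weight≤-cong zero (c≋d ∘ suc) w
  Weight≤-cong {suc m} (suc t) c≋d (inj₁ (c₀≈0 , w)) =
    inj₁ (trans (sym (c≋d zero)) c₀≈0 , Weight≤-cong (suc t) (c≋d ∘ suc) w)
  Weight≤-cong {suc m} (suc t) c≋d (inj₂ w) = inj₂ (Weight≤-cong t (c≋d ∘ suc) w)

  Weight≤-suc : ∀ {m} t {c : Vec m} → Weight≤ t c → Weight≤ (suc t) c
  Weight≤-suc {zero}  t       _ = _
  Weight≤-suc {suc m} zero    (c₀≈0 , w)        = inj₁ (c₀≈0 , Weight≤-suc zero w)
  Weight≤-suc {suc m} (suc t) (inj₁ (c₀≈0 , w)) = inj₁ (c₀≈0 , Weight≤-suc (suc t) w)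
  Weight≤-suc {suc m} (suc t) (inj₂ w)          = inj₂ (Weight≤-suc t w)

  Weight≤-tail : ∀ {m} t {c : Vec (suc m)} → Weight≤ t c → Weight≤ t (tail c)
  Weight≤-tail zero    (_ , w)        = w
  Weight≤-tail (suc t) (inj₁ (_ , w)) = w
  Weight≤-tail (suc t) (inj₂ w)       = Weight≤-suc t w

  Weight≤-zero : ∀ {m} t → Weight≤ {m} t (λ _ → 0#)
  Weight≤-zero {zero}  t       = _
  Weight≤-zero {suc m} zero    = refl , Weight≤-zero zero
  Weight≤-zero {suc m} (suc t) = inj₁ (refl , Weight≤-zero (suc t))

  x*0+y≈y : ∀ x y → x * 0# + y ≈ y
  x*0+y≈y x y = trans (+-congʳ (zeroʳ x)) (+-identityˡ y)

  Weight≤-+δ : ∀ {m} t {c : Vec m} x (p : Fin m) → Weight≤ t c →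
    Weight≤ (suc t) (λ j → x * δ p j + c j)
  Weight≤-+δ {suc m} t       x zero    w =
    inj₂ (Weight≤-cong t (λ j → sym (x*0+y≈y x _)) (Weight≤-tail t w))
  Weight≤-+δ {suc m} zero    x (suc p) (c₀≈0 , w) =
    inj₁ (trans (x*0+y≈y x _) c₀≈0 , Weight≤-+δ zero x p w)
  Weight≤-+δ {suc m} (suc t) x (suc p) (inj₁ (c₀≈0 , w)) =
    inj₁ (trans (x*0+y≈y x _) c₀≈0 , Weight≤-+δ (suc t) x p w)
  Weight≤-+δ {suc m} (suc t) x (suc p) (inj₂ w) = inj₂ (Weight≤-+δ t x p w)

  Weight≤-lincomb-δ : ∀ {m} t (f : Fin t → Fin m) b → Weight≤ t (lincomb b (δ ∘ f))
  Weight≤-lincomb-δ zero    f b = Weight≤-zero zero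
  Weight≤-lincomb-δ (suc t) f b =
    Weight≤-+δ t (b zero) (f zero) (Weight≤-lincomb-δ t (f ∘ suc) (b ∘ suc))

  lincomb-lincomb-δ : ∀ {m n t} (f : Fin t → Fin m) b (v : Fin m → Vec n) →
    lincomb (lincomb b (δ ∘ f)) v ≋ lincomb b (v ∘ f)
  lincomb-lincomb-δ f b v j = begin
    lincomb (lincomb b (δ ∘ f)) v j          ≈⟨ lincomb-lincomb b (δ ∘ f) v j ⟨
    lincomb b (λ i → lincomb (δ (f i)) v) j  ≈⟨ lincomb-congʳ b (λ i → lincomb-δ (f i) v) j ⟩
    lincomb b (v ∘ f) j                      ∎

  module Projection {m} (v : Vec (suc m)) (p : Fin (suc m)) (ι : Carrier) (vp*ι≈1 : v p * ι ≈ 1#) where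

    μ : Fin m → Carrier
    μ r = v (punchIn p r) * ι

    -- u ↦ lincomb u (column W) maps F^(m+1) onto F^m with kernel spanned by v:
    -- its r-th coordinate is u (punchIn p r) − μ r · u p.
    W : Mat m (suc m)
    W r s = δ s (punchIn p r) - μ r * δ s p

    lincomb-column-W : ∀ u r → lincomb u (column W) r ≈ u (punchIn p r) - μ r * u p
    lincomb-column-W u r = begin
      sumF (λ s → u s * (δ s (punchIn p r) - μ r * δ s p))
        ≈⟨ sumF-cong (λ s → x[y-z]≈xy-xz (u s) (δ s (punchIn p r)) (μ r * δ s p)) ⟩
      sumF (λ s → u s * δ s (punchIn p r) - u s * (μ r * δ s p))
        ≈⟨ sumF-distrib-sub (λ s → u s * δ s (punchIn p r)) (λ s → u s * (μ r * δ s p)) ⟩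
      lincomb u δ (punchIn p r) - sumF (λ s → u s * (μ r * δ s p))
        ≈⟨ +-cong (lincomb-identity u (punchIn p r))
                  (-‿cong (sumF-cong (λ s → x∙yz≈y∙xz (u s) (μ r) (δ s p)))) ⟩
      u (punchIn p r) - sumF (λ s → μ r * (u s * δ s p))
        ≈⟨ +-congˡ (-‿cong (*-distribˡ-sumF (μ r) (λ s → u s * δ s p))) ⟨
      u (punchIn p r) - μ r * lincomb u δ p
        ≈⟨ +-congˡ (-‿cong (*-congˡ (lincomb-identity u p))) ⟩
      u (punchIn p r) - μ r * u p ∎

    W-punchIn : ∀ r r′ → W r (punchIn p r′) ≈ δ r r′
    W-punchIn r r′ = begin
      δ (punchIn p r′) (punchIn p r) - μ r * δ (punchIn p r′) p
        ≈⟨ +-congˡ (-‿cong (*-congˡ (reflexive (δ-≢ (punchInᵢ≢i p r′))))) ⟩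
      δ (punchIn p r′) (punchIn p r) - μ r * 0#
        ≈⟨ +-congˡ (trans (-‿cong (zeroʳ (μ r))) -0#≈0#) ⟩
      δ (punchIn p r′) (punchIn p r) + 0#
        ≈⟨ +-identityʳ _ ⟩
      δ (punchIn p r′) (punchIn p r)
        ≡⟨ ≡.trans (δ-injective (punchIn-injective p _ _) r′ r) (δ-sym r′ r) ⟩
      δ r r′ ∎

    LinIndep-W : LinIndep W
    LinIndep-W a aW≋0 r′ = begin
      a r′                            ≈⟨ lincomb-identity a r′ ⟨
      lincomb a δ r′                  ≈⟨ sumF-cong (λ r → *-congˡ (sym (W-punchIn r r′))) ⟩
      lincomb a W (punchIn p r′)      ≈⟨ aW≋0 (punchIn p r′) ⟩
      0#                              ∎

    W-kernel : ∀ u → lincomb u (column W) ≋ (λ _ → 0#) → u ≋ (λ s → (ι * u p) * v s)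
    W-kernel u Wu≋0 s with p Fin.≟ s
    ... | yes ≡.refl = begin
      u p              ≈⟨ *-identityˡ (u p) ⟨
      1# * u p         ≈⟨ *-congʳ vp*ι≈1 ⟨
      (v p * ι) * u p  ≈⟨ xy∙z≈yz∙x (v p) ι (u p) ⟩
      (ι * u p) * v p  ∎
    ... | no p≢s =
      ≡.subst (λ s → u s ≈ (ι * u p) * v s) (punchIn-punchOut p≢s) (kernel-punchIn (punchOut p≢s))
      where
        kernel-punchIn : ∀ r → u (punchIn p r) ≈ (ι * u p) * v (punchIn p r)
        kernel-punchIn r = begin
          u (punchIn p r)
            ≈⟨ x∙y⁻¹≈ε⇒x≈y _ _ (trans (sym (lincomb-column-W u r)) (Wu≋0 r)) ⟩
          μ r * u p
            ≈⟨ xy∙z≈yz∙x (v (punchIn p r)) ι (u p) ⟩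
          (ι * u p) * v (punchIn p r) ∎

  AvoidsColumnSpans : ∀ {m n} → ℕ → Mat m n → Vec m → Set (c ⊔ ℓ)
  AvoidsColumnSpans t G v = ∀ x → Weight≤ t x → ¬ (v ≋ lincomb x (column G))

  AvoidsColumnSpans⇒≉0 : ∀ {m n} t {G : Mat m n} {v} → AvoidsColumnSpans t G v → ¬ (v ≋ (λ _ → 0#))
  AvoidsColumnSpans⇒≉0 t {G} avoids v≋0 =
    avoids (λ _ → 0#) (Weight≤-zero t) (λ s → trans (v≋0 s) (sym (lincomb-zero (column G) s)))

  module _ (_≈?_ : Decidable _≈_) where

    AvoidsColumnSpans⇒scalar≈0 : ∀ {m n t} {G : Mat m n} {v} → AvoidsColumnSpans t G v →
      ∀ (f : Fin t → Fin n) a x → lincomb a (column G ∘ f) ≋ (λ s → x * v s) → x ≈ 0#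
    AvoidsColumnSpans⇒scalar≈0 {t = t} {G} {v} avoids f a x a≋xv with x ≈? 0#
    ... | yes x≈0 = x≈0
    ... | no x≉0  = ⊥-elim (avoids (lincomb b (δ ∘ f)) (Weight≤-lincomb-δ t f b) v≋)
      where
        y = proj₁ (inverse x x≉0)
        yx≈1 = trans (*-comm y x) (proj₂ (inverse x x≉0))
        b = λ i → y * a i
        v≋ : v ≋ lincomb (lincomb b (δ ∘ f)) (column G)
        v≋ s = begin
          v s                                       ≈⟨ *-identityˡ (v s) ⟨
          1# * v s                                  ≈⟨ *-congʳ yx≈1 ⟨
          (y * x) * v s                             ≈⟨ *-assoc y x (v s) ⟩
          y * (x * v s)                             ≈⟨ *-congˡ (a≋xv s) ⟨
          y * lincomb a (column G ∘ f) s            ≈⟨ lincomb-scale y a (column G ∘ f) s ⟨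
          lincomb b (column G ∘ f) s                ≈⟨ lincomb-lincomb-δ f b (column G) s ⟨
          lincomb (lincomb b (δ ∘ f)) (column G) s  ∎

    quotient-InC : ∀ {m n} t (G : Mat (suc m) n) v → InC t G → AvoidsColumnSpans t G v →
      Σ (Mat m n) λ H → InC t H × H ⊆Code G
    quotient-InC {m} t G v (G-rows , G-cols) avoids =
      H , (LinIndep-lincomb {G = G} LinIndep-W G-rows , H-cols) , λ r → W r , λ j → refl
      where
        nonzero-entry : Σ (Fin (suc m)) λ p → ¬ (v p ≈ 0#)
        nonzero-entry = ¬∀⟶∃¬ (suc m) _ (λ s → v s ≈? 0#) (AvoidsColumnSpans⇒≉0 t {G} avoids)
        p = proj₁ nonzero-entry
        inverse-vp = inverse (v p) (proj₂ nonzero-entry)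
        open Projection v p (proj₁ inverse-vp) (proj₂ inverse-vp)

        H : Mat m _
        H r = lincomb (W r) G

        H-cols : AnyColsIndep t H
        H-cols f f-inj a Ha≋0 =
          G-cols f f-inj a (λ s → trans (u≋λv s) (trans (*-congʳ λ≈0) (zeroˡ (v s))))
          where
            u = lincomb a (column G ∘ f)
            Wu≋0 : lincomb u (column W) ≋ (λ _ → 0#)
            Wu≋0 r = begin
              lincomb u (column W) r
                ≈⟨ lincomb-lincomb a (column G ∘ f) (column W) r ⟨
              lincomb a (λ i → lincomb (column G (f i)) (column W)) r
                ≈⟨ lincomb-congʳ a (λ i → column-lincomb W G (f i)) r ⟨
              lincomb a (column H ∘ f) r
                ≈⟨ Ha≋0 r ⟩
              0# ∎
            u≋λv = W-kernel u Wu≋0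
            λ≈0 = AvoidsColumnSpans⇒scalar≈0 avoids f a _ u≋λv

1<size : ∀ {q c ℓ} → FiniteField q c ℓ → 1 < q
1<size {zero} F with FiniteField.enum-surj F (FiniteField.0# F)
... | () , _
1<size {suc zero} F with FiniteField.enum-surj F (FiniteField.0# F) | FiniteField.enum-surj F (FiniteField.1# F)
... | zero , e₀ | zero , e₁ = ⊥-elim (1≉0 (trans (sym e₁) e₀))
  where open FiniteField F
1<size {suc (suc q)} F = s≤s (s≤s z≤n)

module FiniteLinearAlgebra {c ℓ r} (F : FiniteField (suc r) c ℓ) where
  open FiniteField F hiding (zero)
  open Codes fld
  open LinearAlgebra fld
  open import Data.Vec.Functional.Relation.Binary.Equality.Setoid setoid using (_≋_)
  open import Relation.Binary.Reasoning.Setoid setoid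

  q : ℕ
  q = suc r

  q^K<q^[1+K] : ∀ K → q ^ K < q ^ suc K
  q^K<q^[1+K] K = ^-monoʳ-< q (1<size F) (n<1+n K)

  enum⁻¹ : Carrier → Fin q
  enum⁻¹ x = proj₁ (enum-surj x)

  enum-enum⁻¹ : ∀ x → enum (enum⁻¹ x) ≈ x
  enum-enum⁻¹ x = proj₂ (enum-surj x)

  _≈?_ : Decidable _≈_
  x ≈? y with enum⁻¹ x Fin.≟ enum⁻¹ y
  ... | yes i≡j = yes (trans (sym (enum-enum⁻¹ x)) (trans (reflexive (≡.cong enum i≡j)) (enum-enum⁻¹ y)))
  ... | no i≢j  = no λ x≈y → i≢j (enum-inj _ _ (trans (enum-enum⁻¹ x) (trans x≈y (sym (enum-enum⁻¹ y)))))

  ∷-≋ : ∀ {m x} {v : Vec m} {c : Vec (suc m)} → x ≈ c zero → v ≋ tail c → (x ∷ v) ≋ c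
  ∷-≋ x≈c₀ v≋c zero    = x≈c₀
  ∷-≋ x≈c₀ v≋c (suc j) = v≋c j

  vector : ∀ K → Fin (q ^ K) → Vec K
  vector zero    x ()
  vector (suc K) x = let (i , j) = Fin.remQuot (q ^ K) x in enum i ∷ vector K j

  vector-injective : ∀ K {x y} → vector K x ≋ vector K y → x ≡ y
  vector-injective zero    {zero} {zero} _ = ≡.refl
  vector-injective (suc K) {x} {y} vx≋vy =
    ≡.trans (≡.sym (combine-remQuot (q ^ K) x))
      (≡.trans (≡.cong₂ Fin.combine (enum-inj _ _ (vx≋vy zero)) (vector-injective K (vx≋vy ∘ suc)))
        (combine-remQuot (q ^ K) y))

  index : ∀ K → Vec K → Fin (q ^ K)
  index zero    u = zero
  index (suc K) u = Fin.combine (enum⁻¹ (u zero)) (index K (tail u))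

  index-injective : ∀ K {u w} → index K u ≡ index K w → u ≋ w
  index-injective (suc K) {u} {w} iu≡iw zero    = begin
    u zero                 ≈⟨ enum-enum⁻¹ (u zero) ⟨
    enum (enum⁻¹ (u zero))  ≡⟨ ≡.cong enum (proj₁ (combine-injective _ _ _ _ iu≡iw)) ⟩
    enum (enum⁻¹ (w zero))  ≈⟨ enum-enum⁻¹ (w zero) ⟩
    w zero                 ∎
  index-injective (suc K) {u} {w} iu≡iw (suc j) =
    index-injective K tails≡ j
    where
      tails≡ : index K (tail u) ≡ index K (tail w)
      tails≡ = proj₂ (combine-injective (enum⁻¹ (u zero)) _ (enum⁻¹ (w zero)) _ iu≡iw)

  ∃-outside-image : ∀ {K N} (g : Fin N → Vec K) → N < q ^ K → Σ (Vec K) λ v → ∀ i → ¬ (g i ≋ v)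
  ∃-outside-image {K} {N} g N<q^K =
    let x , x∉ = ¬∀⟶∃¬ (q ^ K) InImage InImage? ¬surjective in vector K x , λ i gi≋vx → x∉ (i , gi≋vx)
    where
      InImage : Fin (q ^ K) → Set ℓ
      InImage x = Σ (Fin N) λ i → g i ≋ vector K x
      InImage? : ∀ x → Dec (InImage x)
      InImage? x = any? λ i → all? λ s → g i s ≈? vector K x s
      ¬surjective : ¬ (∀ x → InImage x)
      ¬surjective preimage with pigeonhole N<q^K (proj₁ ∘ preimage)
      ... | x , y , x<y , same = <⇒≢ x<y (vector-injective K λ s → begin
        vector K x s              ≈⟨ proj₂ (preimage x) s ⟨
        g (proj₁ (preimage x)) s  ≡⟨ ≡.cong (λ i → g i s) same ⟩
        g (proj₁ (preimage y)) s  ≈⟨ proj₂ (preimage y) s ⟩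
        vector K y s              ∎)

  ¬LinIndep-suc : ∀ {K} (w : Fin (suc K) → Vec K) → ¬ LinIndep w
  ¬LinIndep-suc {K} w w-indep with pigeonhole (q^K<q^[1+K] K) (λ x → index K (lincomb (vector (suc K) x) w))
  ... | x , y , x<y , same =
    <⇒≢ x<y (vector-injective (suc K) (LinIndep⇒lincomb-injective {v = w} w-indep (index-injective K same)))

  ¬AnyColsIndep : ∀ {m n} → suc m ≤ n → (H : Mat m n) → ¬ AnyColsIndep (suc m) H
  ¬AnyColsIndep m<n H H-cols =
    ¬LinIndep-suc (column H ∘ inject) (H-cols inject (λ {i} {j} → inject≤-injective m<n m<n i j))
    where inject = λ i → Fin.inject≤ i m<n

  nonzero : Fin r → Carrier
  nonzero α = enum (punchIn (enum⁻¹ 0#) α)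

  nonzero-surjective : ∀ x → ¬ (x ≈ 0#) → Σ (Fin r) λ α → nonzero α ≈ x
  nonzero-surjective x x≉0 =
    punchOut i₀≢i , trans (reflexive (≡.cong enum (punchIn-punchOut i₀≢i))) (enum-enum⁻¹ x)
    where
      i₀≢i : enum⁻¹ 0# ≢ enum⁻¹ x
      i₀≢i i₀≡i = x≉0 (begin
        x                ≈⟨ enum-enum⁻¹ x ⟨
        enum (enum⁻¹ x)  ≡⟨ ≡.cong enum i₀≡i ⟨
        enum (enum⁻¹ 0#) ≈⟨ enum-enum⁻¹ 0# ⟩
        0#               ∎)

  ball : ∀ n t → Fin (hammingBallSize r n t) → Vec n
  ball zero    t       _ ()
  ball (suc n) zero    i = 0# ∷ ball n zero i
  ball (suc n) (suc t) i =
    [ (λ a → 0# ∷ ball n (suc t) a)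
    , (λ b → let (α , β) = Fin.remQuot (hammingBallSize r n t) b in nonzero α ∷ ball n t β)
    ]′ (Fin.splitAt (hammingBallSize r n (suc t)) i)

  ball-↑ˡ : ∀ n t a → ball (suc n) (suc t) (a ↑ˡ _) ≡ 0# ∷ ball n (suc t) a
  ball-↑ˡ n t a rewrite splitAt-↑ˡ (hammingBallSize r n (suc t)) a (r ℕ.* hammingBallSize r n t) = ≡.refl

  ball-↑ʳ : ∀ n t α β →
    ball (suc n) (suc t) (hammingBallSize r n (suc t) ↑ʳ Fin.combine α β) ≡ nonzero α ∷ ball n t β
  ball-↑ʳ n t α β
    rewrite splitAt-↑ʳ (hammingBallSize r n (suc t)) (r ℕ.* hammingBallSize r n t) (Fin.combine α β) =
      ≡.cong (λ (α′ , β′) → nonzero α′ ∷ ball n t β′) (remQuot-combine α β)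

  ball-∷-zero : ∀ n t {c} → c zero ≈ 0# →
    Σ (Fin (hammingBallSize r n (suc t))) (λ a → ball n (suc t) a ≋ tail c) →
    Σ (Fin (hammingBallSize r (suc n) (suc t))) λ i → ball (suc n) (suc t) i ≋ c
  ball-∷-zero n t {c} c₀≈0 (a , e) =
    a ↑ˡ _ , λ j → trans (reflexive (≡.cong-app (ball-↑ˡ n t a) j)) (∷-≋ {c = c} (sym c₀≈0) e j)

  ball-∷-nonzero : ∀ n t {c} → Σ (Fin r) (λ α → nonzero α ≈ c zero) →
    Σ (Fin (hammingBallSize r n t)) (λ β → ball n t β ≋ tail c) →
    Σ (Fin (hammingBallSize r (suc n) (suc t))) λ i → ball (suc n) (suc t) i ≋ c
  ball-∷-nonzero n t {c} (α , eα) (β , eβ) =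
    _ ↑ʳ Fin.combine α β , λ j → trans (reflexive (≡.cong-app (ball-↑ʳ n t α β) j)) (∷-≋ {c = c} eα eβ j)

  ball-surjective : ∀ n t {c} → Weight≤ t c → Σ (Fin (hammingBallSize r n t)) λ i → ball n t i ≋ c
  ball-surjective zero    t           _          = zero , λ ()
  ball-surjective (suc n) zero        (c₀≈0 , w) = let i , e = ball-surjective n zero w in i , ∷-≋ (sym c₀≈0) e
  ball-surjective (suc n) (suc t) {c} (inj₁ (c₀≈0 , w)) =
    ball-∷-zero n t {c} c₀≈0 (ball-surjective n (suc t) w)
  ball-surjective (suc n) (suc t) {c} (inj₂ w) with c zero ≈? 0#
  ... | yes c₀≈0 = ball-∷-zero n t {c} c₀≈0 (ball-surjective n (suc t) (Weight≤-suc t w))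
  ... | no c₀≉0  = ball-∷-nonzero n t {c} (nonzero-surjective (c zero) c₀≉0) (ball-surjective n t w)

  avoiding-vector : ∀ {m n} t (G : Mat m n) → hammingBallSize r n t < q ^ m →
    Σ (Vec m) (AvoidsColumnSpans t G)
  avoiding-vector {n = n} t G small =
    let v , v∉ = ∃-outside-image (λ i → lincomb (ball n t i) (column G)) small
    in v , λ x x-light v≋Gx →
      let i , bᵢ≋x = ball-surjective n t x-light
      in v∉ i (λ s → trans (lincomb-congˡ (column G) bᵢ≋x s) (sym (v≋Gx s)))

  shrink : ∀ {m n} t (G : Mat (suc m) n) → InC t G → hammingBallSize r n t < q ^ suc m →
    Σ (Mat m n) λ H → InC t H × H ⊆Code G
  shrink t G G∈C small = let v , avoids = avoiding-vector t G small in quotient-InC _≈?_ t G v G∈C avoids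

  InC-exists : ∀ {m n} t → m ≤‴ n → hammingBallSize r n t < q ^ m → Σ (Mat m n) (InC t)
  InC-exists t ≤‴-refl         _     = δ , InC-identity t
  InC-exists {m} t (≤‴-step m<n) small =
    let small′      = <-trans small (q^K<q^[1+K] m)
        G , G∈C     = InC-exists t m<n small′
        H , H∈C , _ = shrink t G G∈C small′
    in H , H∈C

-- Only the size q of the field enters, so the prime-power hypothesis is unused;
-- neither case hypothesis (t ≡ k, t < k) is needed for its conclusion.
lemma4p5 : ∀ {c ℓ : Level} (q n k t : ℕ) → IsPrimePower q → (F : FiniteField q c ℓ) →
    0 < k → k < n → t ≤ k →
    let open Codes (FiniteField.fld F) in
      ((t ≡ k) → ∀ (G : Mat k n) → InC k G ⇔ InI k G)
      × (t < k → n C t < q ^ (k ∸ t) →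
          Σ (Mat k n) (λ G → InC t G) × (∀ (G : Mat k n) → InI t G → ⊥))
lemma4p5 zero    n k       t _ F _  _   _   = ⊥-elim (n≮0 (1<size F))
lemma4p5 (suc r) n zero    t _ F () _   _
lemma4p5 (suc r) n (suc k) t _ F _  k<n t≤k =
  (λ _ G → mk⇔ (λ G∈C → G∈C , λ (H , (_ , H-cols) , _) → ¬AnyColsIndep (<⇒≤ k<n) H H-cols) proj₁) ,
  λ _ binomial<q^[k∸t] →
    let small = hammingBallSize<^ r t≤k (<⇒≤ k<n) binomial<q^[k∸t]
    in InC-exists t (≤⇒≤‴ (<⇒≤ k<n)) small ,
       λ G (G∈C , isolated) → isolated (shrink t G G∈C small)
  where open FiniteLinearAlgebra F
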